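{- For all integers $k \geq 2$ and $\alpha,\beta \geq 0$, $$C_{k,(\alpha,\beta)}(t) = \sum_{i=0}^{\min(\alpha,\beta)} C_{k,(\alpha-i,0)}(t) \, C_k(t)^{\beta-i}.$$
   Context: For an integer $k\ge 2$ and integers $\alpha,\beta, n\ge 0$, let $C^k_{n,(\alpha,\beta)}$ be the number of integer lattice paths from $(0,\alpha)$ to $(kn+\beta-\alpha,\beta)$ using steps $U=(1,1)$ and $D=(1,1-k)$ that stay weakly above the line $y=0$ (such paths have exactly $n$ steps $D$; the empty path counts when $n=0$, $\alpha=\beta$), and $C_{k,(\alpha,\beta)}(t)=\sum_{n\ge0}C^k_{n,(\alpha,\beta)}t^n$. $C_k(t)=\sum_{n\ge0} \frac{1}{kn+1}\binom{kn+1}{n} t^n$ is the $k$-Catalan generating function. -}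

module Defs where

open import Data.Nat using (ℕ; zero; suc; _+_; _*_; _∸_; _≤ᵇ_; _≡ᵇ_; _⊓_)
open import Data.Nat.DivMod using (_/_)
open import Data.Nat.Combinatorics using (_C_)
open import Data.Bool using (Bool; true; false; if_then_else_; _∧_)
open import Data.List using (List; []; _∷_; map; concatMap; length; filterᵇ)

FPS : Set
FPS = ℕ → ℕ

sumTo : ℕ → (ℕ → ℕ) → ℕ
sumTo zero    f = f 0
sumTo (suc m) f = sumTo m f + f (suc m)

_⊛_ : FPS → FPS → FPS
(f ⊛ g) n = sumTo n (λ i → f i * g (n ∸ i))

one : FPS
one zero    = 1
one (suc _) = 0

_^ˢ_ : FPS → ℕ → FPS
f ^ˢ zero  = one
f ^ˢ suc m = f ⊛ (f ^ˢ m)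

sumSer : ℕ → (ℕ → FPS) → FPS
sumSer m F n = sumTo m (λ i → F i n)

-- Lattice path steps: U = (1,1), D = (1,1-k)
data Step : Set where
  U D : Step

allPaths : ℕ → List (List Step)
allPaths zero    = [] ∷ []
allPaths (suc L) = concatMap (λ p → (U ∷ p) ∷ (D ∷ p) ∷ []) (allPaths L)

countD : List Step → ℕ
countD []       = 0
countD (U ∷ s)  = countD s
countD (D ∷ s)  = suc (countD s)

valid : ℕ → ℕ → ℕ → List Step → Bool
valid k h β []      = h ≡ᵇ β
valid k h β (U ∷ s) = valid k (suc h) β s
valid k h β (D ∷ s) = if (k ∸ 1) ≤ᵇ h then valid k (h ∸ (k ∸ 1)) β s else false

-- C^k_{n,(α,β)}: number of paths from (0,α) to (kn+β-α, β) with steps U, D,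
-- staying weakly above y = 0, with exactly n steps D.
-- (Any such path has length kn+β-α; if kn+β < α there are none, and the
-- truncated length 0 then admits no valid path either.)
pathCount : ℕ → ℕ → ℕ → ℕ → ℕ
pathCount k n α β =
  length (filterᵇ (λ s → valid k α β s ∧ (countD s ≡ᵇ n)) (allPaths ((k * n + β) ∸ α)))

Cser : ℕ → ℕ → ℕ → FPS
Cser k α β n = pathCount k n α β

Cat : ℕ → FPS
Cat k n = (suc (k * n) C n) / suc (k * n)

module Submission where

-- Write F h β for the series C_{k,(h,β)}. Cutting a path that ends at height β + 1 at its
-- last visit to height 0 (after which it steps U and stays at height ≥ 1) gives
--   F h (β + 1) = F (h - 1) β + F h 0 · F 0 β,
-- with F (-1) β = 0 counting the paths that never visit 0. At h = 0 this gives
-- F 0 β = (F 0 0)^(β + 1), and F 0 0 = C_k by the ballot formula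
--   (kn + β + 1) · [tⁿ] F 0 β = (β + 1) · binom(kn + β + 1, n),
-- proved by induction on the length through the last step. Unfolding the cut identity
-- α ⊓ β times gives the formula. The cut identity itself is proved by induction on the
-- length through the first step.

open import Data.Bool using (Bool; true; false; if_then_else_; _∧_; T)
open import Data.Bool.Properties using (∧-zeroʳ)
open import Data.Empty using (⊥-elim)
open import Data.List using (List; []; _∷_; concatMap; length; filterᵇ)
open import Data.Nat using (ℕ; zero; suc; _+_; _*_; _∸_; _≤_; _<_; _≤ᵇ_; _≡ᵇ_; _⊓_; z≤n; s≤s)
open import Data.Nat.Combinatorics using (_C_; nC1≡n; nCk+nC[k+1]≡[n+1]C[k+1])
open import Data.Nat.DivMod using (_/_; m*n/n≡m)
open import Data.Nat.Properties
open import Algebra.Properties.CommutativeSemigroup +-commutativeSemigroup using (interchange)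
open import Data.Nat.Tactic.RingSolver using (solve-∀)
open import Relation.Binary.PropositionalEquality
open import Relation.Nullary using (yes; no)

open import Defs

open ≡-Reasoning

sumTo-cong : ∀ n {f g : ℕ → ℕ} → (∀ i → i ≤ n → f i ≡ g i) → sumTo n f ≡ sumTo n g
sumTo-cong zero    f≗g = f≗g 0 z≤n
sumTo-cong (suc n) f≗g =
  cong₂ _+_ (sumTo-cong n (λ i i≤n → f≗g i (m≤n⇒m≤1+n i≤n))) (f≗g (suc n) ≤-refl)

sumTo-zero : ∀ n {f : ℕ → ℕ} → (∀ i → i ≤ n → f i ≡ 0) → sumTo n f ≡ 0
sumTo-zero zero    f≗0 = f≗0 0 z≤n
sumTo-zero (suc n) f≗0 =
  cong₂ _+_ (sumTo-zero n (λ i i≤n → f≗0 i (m≤n⇒m≤1+n i≤n))) (f≗0 (suc n) ≤-refl)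

sumTo-+ : ∀ n (f g : ℕ → ℕ) → sumTo n (λ i → f i + g i) ≡ sumTo n f + sumTo n g
sumTo-+ zero    f g = refl
sumTo-+ (suc n) f g = trans (cong (_+ (f (suc n) + g (suc n))) (sumTo-+ n f g))
                            (interchange (sumTo n f) (sumTo n g) (f (suc n)) (g (suc n)))

sumTo-suc : ∀ n (f : ℕ → ℕ) → sumTo (suc n) f ≡ f 0 + sumTo n (λ i → f (suc i))
sumTo-suc zero    f = refl
sumTo-suc (suc n) f = trans (cong (_+ f (suc (suc n))) (sumTo-suc n f)) (+-assoc (f 0) _ _)

0ˢ : FPS
0ˢ _ = 0

shift : FPS → FPS
shift f zero    = 0
shift f (suc n) = f n

shift-cong : ∀ {f g : FPS} → (∀ m → f m ≡ g m) → ∀ n → shift f n ≡ shift g n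
shift-cong f≗g zero    = refl
shift-cong f≗g (suc n) = f≗g n

shift-+ : ∀ (f g : FPS) n → shift (λ m → f m + g m) n ≡ shift f n + shift g n
shift-+ f g zero    = refl
shift-+ f g (suc n) = refl

shift-0 : ∀ n → shift 0ˢ n ≡ 0
shift-0 zero    = refl
shift-0 (suc n) = refl

⊛-cong : ∀ {f f′ g g′ : FPS} → (∀ i → f i ≡ f′ i) → (∀ i → g i ≡ g′ i) →
         ∀ n → (f ⊛ g) n ≡ (f′ ⊛ g′) n
⊛-cong f≗f′ g≗g′ n = sumTo-cong n (λ i _ → cong₂ _*_ (f≗f′ i) (g≗g′ (n ∸ i)))

⊛-zeroˡ : ∀ {f : FPS} (g : FPS) n → (∀ i → i ≤ n → f i ≡ 0) → (f ⊛ g) n ≡ 0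
⊛-zeroˡ g n f≗0 = sumTo-zero n (λ i i≤n → cong (_* g (n ∸ i)) (f≗0 i i≤n))

⊛-identityˡ : ∀ (f : FPS) n → (one ⊛ f) n ≡ f n
⊛-identityˡ f zero    = +-identityʳ (f 0)
⊛-identityˡ f (suc n) = begin
  sumTo (suc n) (λ i → one i * f (suc n ∸ i))  ≡⟨ sumTo-suc n _ ⟩
  f (suc n) + 0 + sumTo n (λ _ → 0)           ≡⟨ cong₂ _+_ (+-identityʳ _) (sumTo-zero n (λ _ _ → refl)) ⟩
  f (suc n) + 0                               ≡⟨ +-identityʳ _ ⟩
  f (suc n)                                   ∎

⊛-identityʳ : ∀ (f : FPS) n → (f ⊛ one) n ≡ f n
⊛-identityʳ f zero    = *-identityʳ (f 0)
⊛-identityʳ f (suc n) = cong₂ _+_ (sumTo-zero n earlier) last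
  where
  earlier : ∀ i → i ≤ n → f i * one (suc n ∸ i) ≡ 0
  earlier i i≤n = trans (cong (λ j → f i * one j) (+-∸-assoc 1 i≤n)) (*-zeroʳ (f i))
  last : f (suc n) * one (n ∸ n) ≡ f (suc n)
  last = trans (cong (λ j → f (suc n) * one j) (n∸n≡0 n)) (*-identityʳ _)

⊛-distribʳ-+ : ∀ (f g x : FPS) n → ((λ i → f i + g i) ⊛ x) n ≡ (f ⊛ x) n + (g ⊛ x) n
⊛-distribʳ-+ f g x n =
  trans (sumTo-cong n (λ i _ → *-distribʳ-+ (x (n ∸ i)) (f i) (g i)))
        (sumTo-+ n (λ i → f i * x (n ∸ i)) (λ i → g i * x (n ∸ i)))

⊛-shiftˡ : ∀ (f x : FPS) n → (shift f ⊛ x) n ≡ shift (f ⊛ x) n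
⊛-shiftˡ f x zero    = refl
⊛-shiftˡ f x (suc n) = sumTo-suc n _

-- down j g h = g (h ∸ suc j), read as 0 when h ≤ j (a height below 0).
down : ℕ → (ℕ → ℕ) → ℕ → ℕ
down j       g zero    = 0
down zero    g (suc h) = g h
down (suc j) g (suc h) = down j g h

down-cong : ∀ j h {g g′ : ℕ → ℕ} → (∀ h′ → h′ + suc j ≡ h → g h′ ≡ g′ h′) →
            down j g h ≡ down j g′ h
down-cong j       zero    g≗g′ = refl
down-cong zero    (suc h) g≗g′ = g≗g′ h (+-comm h 1)
down-cong (suc j) (suc h) g≗g′ =
  down-cong j h (λ h′ eq → g≗g′ h′ (trans (+-suc h′ (suc j)) (cong suc eq)))

down-+ : ∀ j h (f g : ℕ → ℕ) → down j (λ h′ → f h′ + g h′) h ≡ down j f h + down j g h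
down-+ j       zero    f g = refl
down-+ zero    (suc h) f g = refl
down-+ (suc j) (suc h) f g = down-+ j h f g

down-0 : ∀ j h → down j 0ˢ h ≡ 0
down-0 j       zero    = refl
down-0 zero    (suc h) = refl
down-0 (suc j) (suc h) = down-0 j h

down-down : ∀ j h (g : ℕ → ℕ) → down j (down 0 g) (suc h) ≡ down j g h
down-down zero    h       g = refl
down-down (suc j) zero    g = refl
down-down (suc j) (suc h) g = down-down j h g

down-shift : ∀ j h (G : ℕ → FPS) m →
             down j (λ h′ → shift (G h′) m) h ≡ shift (λ m′ → down j (λ h′ → G h′ m′) h) m
down-shift j h G zero    = down-0 j h
down-shift j h G (suc m) = refl

down-⊛ : ∀ j h (G : ℕ → FPS) (x : FPS) n →
         ((λ i → down j (λ h′ → G h′ i) h) ⊛ x) n ≡ down j (λ h′ → (G h′ ⊛ x) n) h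
down-⊛ j       zero    G x n = ⊛-zeroˡ x n (λ _ _ → refl)
down-⊛ zero    (suc h) G x n = refl
down-⊛ (suc j) (suc h) G x n = down-⊛ j h G x n

[k+1]*[n+1]C[k+1]≡[n+1]*nCk : ∀ n k → suc k * (suc n C suc k) ≡ suc n * (n C k)
[k+1]*[n+1]C[k+1]≡[n+1]*nCk zero    zero    = refl
[k+1]*[n+1]C[k+1]≡[n+1]*nCk zero    (suc k) = *-zeroʳ (2 + k)
[k+1]*[n+1]C[k+1]≡[n+1]*nCk (suc n) zero    =
  trans (+-identityʳ _) (trans (nC1≡n (2 + n)) (sym (*-identityʳ (2 + n))))
[k+1]*[n+1]C[k+1]≡[n+1]*nCk (suc n) (suc k) = begin
  (2 + k) * ((2 + n) C (2 + k))
    ≡⟨ cong ((2 + k) *_) (sym (nCk+nC[k+1]≡[n+1]C[k+1] (suc n) (suc k))) ⟩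
  (2 + k) * ((1 + n) C (1 + k) + (1 + n) C (2 + k))
    ≡⟨ *-distribˡ-+ (2 + k) ((1 + n) C (1 + k)) _ ⟩
  ((1 + n) C (1 + k) + (1 + k) * ((1 + n) C (1 + k))) + (2 + k) * ((1 + n) C (2 + k))
    ≡⟨ cong₂ (λ a b → ((1 + n) C (1 + k) + a) + b)
             ([k+1]*[n+1]C[k+1]≡[n+1]*nCk n k) ([k+1]*[n+1]C[k+1]≡[n+1]*nCk n (suc k)) ⟩
  ((1 + n) C (1 + k) + (1 + n) * (n C k)) + (1 + n) * (n C (1 + k))
    ≡⟨ +-assoc ((1 + n) C (1 + k)) _ _ ⟩
  (1 + n) C (1 + k) + ((1 + n) * (n C k) + (1 + n) * (n C (1 + k)))
    ≡⟨ cong ((1 + n) C (1 + k) +_) (sym (*-distribˡ-+ (1 + n) (n C k) _)) ⟩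
  (1 + n) C (1 + k) + (1 + n) * (n C k + n C (1 + k))
    ≡⟨ cong (λ c → (1 + n) C (1 + k) + (1 + n) * c) (nCk+nC[k+1]≡[n+1]C[k+1] n k) ⟩
  (2 + n) * ((1 + n) C (1 + k))
    ∎

[k+1]*nC[k+1]+k*nCk≡n*nCk : ∀ n k → suc k * (n C suc k) + k * (n C k) ≡ n * (n C k)
[k+1]*nC[k+1]+k*nCk≡n*nCk zero    zero    = refl
[k+1]*nC[k+1]+k*nCk≡n*nCk zero    (suc k) =
  cong₂ _+_ (*-zeroʳ (2 + k)) (*-zeroʳ (1 + k))
[k+1]*nC[k+1]+k*nCk≡n*nCk (suc n) zero    =
  trans (+-identityʳ _) ([k+1]*[n+1]C[k+1]≡[n+1]*nCk n zero)
[k+1]*nC[k+1]+k*nCk≡n*nCk (suc n) (suc k) = begin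
  (2 + k) * ((1 + n) C (2 + k)) + (1 + k) * ((1 + n) C (1 + k))
    ≡⟨ cong₂ _+_ ([k+1]*[n+1]C[k+1]≡[n+1]*nCk n (suc k)) ([k+1]*[n+1]C[k+1]≡[n+1]*nCk n k) ⟩
  (1 + n) * (n C (1 + k)) + (1 + n) * (n C k)
    ≡⟨ sym (*-distribˡ-+ (1 + n) (n C (1 + k)) (n C k)) ⟩
  (1 + n) * (n C (1 + k) + n C k)
    ≡⟨ cong ((1 + n) *_) (trans (+-comm (n C (1 + k)) (n C k)) (nCk+nC[k+1]≡[n+1]C[k+1] n k)) ⟩
  (1 + n) * ((1 + n) C (1 + k))
    ∎

length-filterᵇ-false : ∀ {A : Set} (P : A → Bool) xs → (∀ x → P x ≡ false) →
                       length (filterᵇ P xs) ≡ 0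
length-filterᵇ-false P []       P≡false = refl
length-filterᵇ-false P (x ∷ xs) P≡false rewrite P≡false x = length-filterᵇ-false P xs P≡false

length-filterᵇ-pairs : ∀ {A B : Set} (P : B → Bool) (f g : A → B) xs →
  length (filterᵇ P (concatMap (λ x → f x ∷ g x ∷ []) xs))
    ≡ length (filterᵇ (λ x → P (f x)) xs) + length (filterᵇ (λ x → P (g x)) xs)
length-filterᵇ-pairs P f g [] = refl
length-filterᵇ-pairs P f g (x ∷ xs) with P (f x)
... | true  with P (g x)
...   | true  = cong suc (trans (cong suc (length-filterᵇ-pairs P f g xs)) (sym (+-suc _ _)))
...   | false = cong suc (length-filterᵇ-pairs P f g xs)
length-filterᵇ-pairs P f g (x ∷ xs) | false with P (g x)
...   | true  = trans (cong suc (length-filterᵇ-pairs P f g xs)) (sym (+-suc _ _))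
...   | false = length-filterᵇ-pairs P f g xs

length-filterᵇ-down : ∀ j h (P : ℕ → List Step → Bool) (Q : List Step → Bool) ss →
  length (filterᵇ (λ s → (if suc j ≤ᵇ h then P (h ∸ suc j) s else false) ∧ Q s) ss)
    ≡ down j (λ h′ → length (filterᵇ (λ s → P h′ s ∧ Q s) ss)) h
length-filterᵇ-down j       zero    P Q ss = length-filterᵇ-false _ ss (λ _ → refl)
length-filterᵇ-down zero    (suc h) P Q ss = refl
length-filterᵇ-down (suc j) (suc h) P Q ss = length-filterᵇ-down j h P Q ss

empty : ℕ → ℕ → FPS
empty h β = if h ≡ᵇ β then one else 0ˢ

empty-≢ : ∀ {h β} → h ≢ β → ∀ n → empty h β n ≡ 0
empty-≢ {h} {β} h≢β n with h ≡ᵇ β in eq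
... | true  = ⊥-elim (h≢β (≡ᵇ⇒≡ h β (subst T (sym eq) _)))
... | false = refl

empty-suc : ∀ h β m → empty h β (suc m) ≡ 0
empty-suc h β m with h ≡ᵇ β
... | true  = refl
... | false = refl

empty-suc-down : ∀ h β n → empty (suc h) β n ≡ down 0 (λ β′ → empty h β′ n) β
empty-suc-down h zero    n = refl
empty-suc-down h (suc β) n = refl

down-empty : ∀ j h β m → down j (λ h′ → empty h′ β m) h ≡ empty h (suc j + β) m
down-empty j       zero    β m = refl
down-empty zero    (suc h) β m = refl
down-empty (suc j) (suc h) β m = down-empty j h β m

-- The D step lowers the height by k - 1 = suc d.
module Paths (d : ℕ) where

  k : ℕ
  k = 2 + d

  stepD : (ℕ → FPS) → ℕ → FPS
  stepD G h = shift (λ m → down d (λ h′ → G h′ m) h)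

  count : ℕ → ℕ → ℕ → FPS
  count zero    h β   = empty h β
  count (suc L) h β n = count L (suc h) β n + stepD (λ h′ → count L h′ β) h n

  count-valid-paths : ∀ L h β n →
    length (filterᵇ (λ s → valid k h β s ∧ (countD s ≡ᵇ n)) (allPaths L)) ≡ count L h β n
  count-valid-paths zero h β zero with h ≡ᵇ β
  ... | true  = refl
  ... | false = refl
  count-valid-paths zero h β (suc n) with h ≡ᵇ β
  ... | true  = refl
  ... | false = refl
  count-valid-paths (suc L) h β n =
    trans (length-filterᵇ-pairs _ (U ∷_) (D ∷_) (allPaths L))
          (cong₂ _+_ (count-valid-paths L (suc h) β n) (after-D n))
    where
    after-D : ∀ n →
      length (filterᵇ (λ s → valid k h β (D ∷ s) ∧ (countD (D ∷ s) ≡ᵇ n)) (allPaths L))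
        ≡ stepD (λ h′ → count L h′ β) h n
    after-D zero    = length-filterᵇ-false _ (allPaths L) (λ _ → ∧-zeroʳ _)
    after-D (suc m) = trans (length-filterᵇ-down d h _ _ (allPaths L))
                            (down-cong d h (λ h′ _ → count-valid-paths L h′ β m))

  Cser-count : ∀ h β n → Cser k h β n ≡ count (k * n + β ∸ h) h β n
  Cser-count h β n = count-valid-paths (k * n + β ∸ h) h β n

  Cser≡count : ∀ L h β n → L + h ≡ k * n + β → Cser k h β n ≡ count L h β n
  Cser≡count L h β n eq =
    trans (Cser-count h β n)
          (cong (λ L′ → count L′ h β n) (trans (cong (_∸ h) (sym eq)) (m+n∸n≡m L h)))

  Cser-above : ∀ h β n → k * n + β ≤ h → Cser k h β n ≡ empty h β n
  Cser-above h β n le =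
    trans (Cser-count h β n) (cong (λ L → count L h β n) (m≤n⇒m∸n≡0 le))

  Cser-vanish : ∀ h β n → k * n + suc β ≤ h → Cser k h β n ≡ 0
  Cser-vanish h β n le =
    trans (Cser-above h β n (≤-trans (+-monoʳ-≤ (k * n) (n≤1+n β)) le))
          (empty-≢ (>⇒≢ (≤-trans (m≤n+m (suc β) (k * n)) le)) n)

  length-after-D : ∀ {L h h′} m {β} → h′ + suc d ≡ h → L + suc h ≡ k * suc m + β →
                   L + h′ ≡ k * m + β
  length-after-D {L} {h′ = h′} m {β} refl eq =
    +-cancelʳ-≡ k (L + h′) (k * m + β) (trans (lhs L h′ d) (trans eq (rhs d m β)))
    where
    lhs : ∀ L h′ d → L + h′ + (2 + d) ≡ L + suc (h′ + suc d)
    lhs = solve-∀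
    rhs : ∀ d m β → (2 + d) * suc m + β ≡ (2 + d) * m + β + (2 + d)
    rhs = solve-∀

  bound-after-D : ∀ {L h h′} m {γ} → h′ + suc d ≡ h → k * suc m + γ ≤ suc L + h →
                  k * m + γ ≤ L + h′
  bound-after-D {L} {h′ = h′} m {γ} refl le =
    +-cancelʳ-≤ k (k * m + γ) (L + h′)
      (subst₂ _≤_ (lhs d m γ) (rhs L h′ d) le)
    where
    lhs : ∀ d m γ → (2 + d) * suc m + γ ≡ (2 + d) * m + γ + (2 + d)
    lhs = solve-∀
    rhs : ∀ L h′ d → suc L + (h′ + suc d) ≡ L + h′ + (2 + d)
    rhs = solve-∀

  Cser-first-step : ∀ h β n →
    Cser k h β n ≡ Cser k (suc h) β n + stepD (λ h′ → Cser k h′ β) h n + empty h β n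
  Cser-first-step h β n with h <? k * n + β
  ... | yes h< = begin
      Cser k h β n
        ≡⟨ Cser≡count (suc L) h β n (trans (sym (+-suc L h)) eq) ⟩
      count (suc L) h β n
        ≡⟨ cong₂ _+_ (sym (Cser≡count L (suc h) β n eq)) (after-D n eq) ⟩
      Cser k (suc h) β n + stepD (λ h′ → Cser k h′ β) h n
        ≡⟨ sym (trans (cong (steps +_) (empty-below n h<)) (+-identityʳ steps)) ⟩
      Cser k (suc h) β n + stepD (λ h′ → Cser k h′ β) h n + empty h β n
        ∎
    where
    L steps : ℕ
    L = k * n + β ∸ suc h
    steps = Cser k (suc h) β n + stepD (λ h′ → Cser k h′ β) h n
    eq : L + suc h ≡ k * n + β
    eq = m∸n+n≡m h<
    after-D : ∀ n → L + suc h ≡ k * n + β →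
      stepD (λ h′ → count L h′ β) h n ≡ stepD (λ h′ → Cser k h′ β) h n
    after-D zero    _  = refl
    after-D (suc m) eq = down-cong d h (λ h′ e → sym (Cser≡count L h′ β m (length-after-D m e eq)))
    empty-below : ∀ n → h < k * n + β → empty h β n ≡ 0
    empty-below zero    h< = empty-≢ (<⇒≢ (subst (h <_) (cong (_+ β) (*-zeroʳ k)) h<)) 0
    empty-below (suc m) _  = empty-suc h β m
  ... | no h≮ = trans (Cser-above h β n le) (sym (cong₂ (λ a b → a + b + empty h β n) top (after-D n le)))
    where
    le : k * n + β ≤ h
    le = ≮⇒≥ h≮
    top : Cser k (suc h) β n ≡ 0
    top = Cser-vanish (suc h) β n (subst (_≤ suc h) (sym (+-suc (k * n) β)) (s≤s le))
    after-D : ∀ n → k * n + β ≤ h → stepD (λ h′ → Cser k h′ β) h n ≡ 0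
    after-D zero    _  = refl
    after-D (suc m) le =
      trans (down-cong d h (λ h′ e → Cser-vanish h′ β m (bound-after-D m e (subst (_≤ suc h) (sym (+-suc _ β)) (s≤s le)))))
            (down-0 d h)

  Cser-⊛-first-step : ∀ h (x : FPS) n →
    (Cser k h 0 ⊛ x) n
      ≡ (Cser k (suc h) 0 ⊛ x) n + stepD (λ h′ → Cser k h′ 0 ⊛ x) h n + (empty h 0 ⊛ x) n
  Cser-⊛-first-step h x n = begin
    (Cser k h 0 ⊛ x) n
      ≡⟨ ⊛-cong {g = x} (Cser-first-step h 0) (λ _ → refl) n ⟩
    ((λ i → next i + D-step i + empty h 0 i) ⊛ x) n
      ≡⟨ ⊛-distribʳ-+ (λ i → next i + D-step i) (empty h 0) x n ⟩
    ((λ i → next i + D-step i) ⊛ x) n + (empty h 0 ⊛ x) n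
      ≡⟨ cong (_+ (empty h 0 ⊛ x) n) (⊛-distribʳ-+ next D-step x n) ⟩
    (next ⊛ x) n + (D-step ⊛ x) n + (empty h 0 ⊛ x) n
      ≡⟨ cong (λ y → (next ⊛ x) n + y + (empty h 0 ⊛ x) n)
              (trans (⊛-shiftˡ _ x n) (shift-cong (down-⊛ d h (λ h′ → Cser k h′ 0) x) n)) ⟩
    (next ⊛ x) n + stepD (λ h′ → Cser k h′ 0 ⊛ x) h n + (empty h 0 ⊛ x) n
      ∎
    where
    next D-step : FPS
    next = Cser k (suc h) 0
    D-step = stepD (λ h′ → Cser k h′ 0) h

  Cser-key : ∀ h β n →
    Cser k h (suc β) n ≡ down 0 (λ h′ → Cser k h′ β n) h + (Cser k h 0 ⊛ Cser k 0 β) n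
  Cser-key h β n = key (k * n + suc β) h n (m≤m+n _ h)
    where
    X : FPS
    X = Cser k 0 β
    -- L bounds the path length; L = 0 is the range of h from which no step fits.
    key : ∀ L h n → k * n + suc β ≤ L + h →
          Cser k h (suc β) n ≡ down 0 (λ h′ → Cser k h′ β n) h + (Cser k h 0 ⊛ X) n
    key zero    zero    n le with ≤-trans (m≤n+m (suc β) (k * n)) le
    ... | ()
    key zero    (suc h) n le = begin
      Cser k (suc h) (suc β) n            ≡⟨ Cser-above (suc h) (suc β) n le ⟩
      empty h β n                         ≡⟨ sym (Cser-above h β n (≤-pred (subst (_≤ suc h) (+-suc _ β) le))) ⟩
      Cser k h β n                        ≡⟨ sym (+-identityʳ _) ⟩
      Cser k h β n + 0                    ≡⟨ cong (Cser k h β n +_) (sym (⊛-zeroˡ X n below)) ⟩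
      Cser k h β n + (Cser k (suc h) 0 ⊛ X) n ∎
      where
      below : ∀ i → i ≤ n → Cser k (suc h) 0 i ≡ 0
      below i i≤n = Cser-vanish (suc h) 0 i (≤-trans (+-mono-≤ (*-monoʳ-≤ k i≤n) (s≤s z≤n))
                                                       (≤-trans (+-monoʳ-≤ (k * n) (s≤s z≤n)) le))
    key (suc L) zero    n le = begin
      Cser k 0 (suc β) n
        ≡⟨ Cser-first-step 0 (suc β) n ⟩
      Cser k 1 (suc β) n + shift 0ˢ n + 0
        ≡⟨ cong₂ (λ a b → a + b + 0) (key L 1 n (≤-trans le (≤-reflexive (sym (+-suc L 0))))) (shift-0 n) ⟩
      Cser k 0 β n + (Cser k 1 0 ⊛ X) n + 0 + 0
        ≡⟨ rearrange (Cser k 0 β n) ((Cser k 1 0 ⊛ X) n) ⟩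
      (Cser k 1 0 ⊛ X) n + 0 + Cser k 0 β n
        ≡⟨ cong₂ (λ a b → (Cser k 1 0 ⊛ X) n + a + b) (sym (shift-0 n)) (sym (⊛-identityˡ X n)) ⟩
      (Cser k 1 0 ⊛ X) n + shift 0ˢ n + (one ⊛ X) n
        ≡⟨ sym (Cser-⊛-first-step 0 X n) ⟩
      (Cser k 0 0 ⊛ X) n
        ∎
      where
      rearrange : ∀ a c → a + c + 0 + 0 ≡ c + 0 + a
      rearrange = solve-∀
    key (suc L) (suc h) n le = begin
      Cser k (suc h) (suc β) n
        ≡⟨ Cser-first-step (suc h) (suc β) n ⟩
      Cser k (2 + h) (suc β) n + stepD (λ h′ → Cser k h′ (suc β)) (suc h) n + empty h β n
        ≡⟨ cong₂ (λ a b → a + b + empty h β n)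
                 (key L (2 + h) n (≤-trans le (≤-reflexive (sym (+-suc L (suc h))))))
                 (after-D n le) ⟩
      (Cser k (suc h) β n + (Cser k (2 + h) 0 ⊛ X) n) + (D-step + D-conv) + empty h β n
        ≡⟨ rearrange (Cser k (suc h) β n) ((Cser k (2 + h) 0 ⊛ X) n) D-step D-conv (empty h β n) ⟩
      (Cser k (suc h) β n + D-step + empty h β n) + ((Cser k (2 + h) 0 ⊛ X) n + D-conv + 0)
        ≡⟨ cong₂ _+_ (sym (Cser-first-step h β n))
                     (cong ((Cser k (2 + h) 0 ⊛ X) n + D-conv +_) (sym (⊛-zeroˡ X n (λ _ _ → refl)))) ⟩
      Cser k h β n + ((Cser k (2 + h) 0 ⊛ X) n + D-conv + (empty (suc h) 0 ⊛ X) n)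
        ≡⟨ cong (Cser k h β n +_) (sym (Cser-⊛-first-step (suc h) X n)) ⟩
      Cser k h β n + (Cser k (suc h) 0 ⊛ X) n
        ∎
      where
      D-step D-conv : ℕ
      D-step = stepD (λ h′ → Cser k h′ β) h n
      D-conv = stepD (λ h′ → Cser k h′ 0 ⊛ X) (suc h) n
      rearrange : ∀ a c b e f → (a + c) + (b + e) + f ≡ (a + b + f) + (c + e + 0)
      rearrange = solve-∀
      after-D : ∀ n → k * n + suc β ≤ suc L + suc h →
        stepD (λ h′ → Cser k h′ (suc β)) (suc h) n
          ≡ stepD (λ h′ → Cser k h′ β) h n
            + stepD (λ h′ → Cser k h′ 0 ⊛ X) (suc h) n
      after-D zero    _  = refl
      after-D (suc m) le = begin
        down d (λ h′ → Cser k h′ (suc β) m) (suc h)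
          ≡⟨ down-cong d (suc h) (λ h′ e → key L h′ m (bound-after-D m e le)) ⟩
        down d (λ h′ → down 0 (λ h″ → Cser k h″ β m) h′ + (Cser k h′ 0 ⊛ X) m) (suc h)
          ≡⟨ down-+ d (suc h) _ _ ⟩
        down d (down 0 (λ h″ → Cser k h″ β m)) (suc h) + down d (λ h′ → (Cser k h′ 0 ⊛ X) m) (suc h)
          ≡⟨ cong (_+ down d (λ h′ → (Cser k h′ 0 ⊛ X) m) (suc h)) (down-down d h _) ⟩
        down d (λ h′ → Cser k h′ β m) h + down d (λ h′ → (Cser k h′ 0 ⊛ X) m) (suc h)
          ∎

  count-last-step : ∀ L h β n →
    count (suc L) h β n ≡ down 0 (λ β′ → count L h β′ n) β + shift (count L h (suc d + β)) n
  count-last-step zero    h β n =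
    cong₂ _+_ (empty-suc-down h β n) (shift-cong (λ m → down-empty d h β m) n)
  count-last-step (suc L) h β n = begin
    count (suc L) (suc h) β n + stepD (λ h′ → count (suc L) h′ β) h n
      ≡⟨ cong₂ _+_ (count-last-step L (suc h) β n) (shift-cong split n) ⟩
    (U-last (suc h) + D-last (suc h) n) + shift (λ m → U-after-D m + D-after-D m) n
      ≡⟨ cong (U-last (suc h) + D-last (suc h) n +_) (shift-+ U-after-D D-after-D n) ⟩
    (U-last (suc h) + D-last (suc h) n) + (shift U-after-D n + shift D-after-D n)
      ≡⟨ interchange (U-last (suc h)) (D-last (suc h) n) (shift U-after-D n) (shift D-after-D n) ⟩
    (U-last (suc h) + shift U-after-D n) + (D-last (suc h) n + shift D-after-D n)
      ≡⟨ cong₂ _+_ (trans (cong (U-last (suc h) +_) (swap β)) (sym (down-+ 0 β _ _)))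
                   (trans (sym (shift-+ _ D-after-D n))
                          (shift-cong (λ m → cong (count L (suc h) (suc d + β) m +_)
                                                  (down-shift d h (λ h′ → count L h′ (suc d + β)) m)) n)) ⟩
    down 0 (λ β′ → count (suc L) h β′ n) β + shift (count (suc L) h (suc d + β)) n
      ∎
    where
    U-last : ℕ → ℕ
    U-last h = down 0 (λ β′ → count L h β′ n) β
    D-last : ℕ → FPS
    D-last h = shift (count L h (suc d + β))
    U-after-D D-after-D : FPS
    U-after-D m = down d (λ h′ → down 0 (λ β′ → count L h′ β′ m) β) h
    D-after-D m = down d (λ h′ → D-last h′ m) h
    split : ∀ m → down d (λ h′ → count (suc L) h′ β m) h ≡ U-after-D m + D-after-D m
    split m = trans (down-cong d h (λ h′ _ → count-last-step L h′ β m)) (down-+ d h _ _)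
    swap : ∀ γ → stepD (λ h′ m → down 0 (λ β′ → count L h′ β′ m) γ) h n
                 ≡ down 0 (λ β′ → stepD (λ h′ → count L h′ β′) h n) γ
    swap zero    = trans (shift-cong (λ _ → down-0 d h) n) (shift-0 n)
    swap (suc γ) = refl

  Cser-last-step : ∀ L β n → k * n + β ≡ suc L →
    Cser k 0 β n ≡ down 0 (λ β′ → Cser k 0 β′ n) β + shift (Cser k 0 (suc d + β)) n
  Cser-last-step L β n eq = begin
    Cser k 0 β n
      ≡⟨ Cser≡count (suc L) 0 β n (trans (+-identityʳ (suc L)) (sym eq)) ⟩
    count (suc L) 0 β n
      ≡⟨ count-last-step L 0 β n ⟩
    down 0 (λ β′ → count L 0 β′ n) β + shift (count L 0 (suc d + β)) n
      ≡⟨ cong₂ _+_ (down-cong 0 β (λ β′ e → sym (Cser≡count L 0 β′ n (after-U e))))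
                   (after-D n eq) ⟩
    down 0 (λ β′ → Cser k 0 β′ n) β + shift (Cser k 0 (suc d + β)) n
      ∎
    where
    after-U : ∀ {β′} → β′ + 1 ≡ β → L + 0 ≡ k * n + β′
    after-U {β′} refl = suc-injective (trans (cong suc (+-identityʳ L)) (sym (trans (shape d n β′) eq)))
      where
      shape : ∀ d n β′ → suc ((2 + d) * n + β′) ≡ (2 + d) * n + (β′ + 1)
      shape = solve-∀
    after-D : ∀ n → k * n + β ≡ suc L →
      shift (count L 0 (suc d + β)) n ≡ shift (Cser k 0 (suc d + β)) n
    after-D zero    _  = refl
    after-D (suc m) eq = sym (Cser≡count L 0 (suc d + β) m
                               (suc-injective (trans (cong suc (+-identityʳ L)) (sym (trans (shape d m β) eq)))))
      where
      shape : ∀ d m β → suc ((2 + d) * m + (suc d + β)) ≡ (2 + d) * suc m + β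
      shape = solve-∀

  ballot-identity : ∀ N n β → k * n + β ≡ N →
    suc N * (β * (N C n) + shift (λ m → suc (suc d + β) * (N C m)) n) ≡ N * (suc β * (suc N C n))
  ballot-identity N zero    β eq = subst (λ N → suc N * (β * 1 + 0) ≡ N * (suc β * 1)) β≡N (identity β)
    where
    β≡N : β ≡ N
    β≡N = trans (sym (cong (_+ β) (*-zeroʳ k))) eq
    identity : ∀ β → suc β * (β * 1 + 0) ≡ β * (suc β * 1)
    identity = solve-∀
  -- Adding k · (N · C(N, m)) to both sides lets the absorption identity turn the goal into a ring identity.
  ballot-identity N (suc m) β refl = +-cancelʳ-≡ (k * (N * b)) _ _ (begin
    suc N * (β * a + suc (suc d + β) * b) + k * (N * b)
      ≡⟨ cong (λ z → suc N * (β * a + suc (suc d + β) * b) + k * z) (sym ([k+1]*nC[k+1]+k*nCk≡n*nCk N m)) ⟩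
    suc N * (β * a + suc (suc d + β) * b) + k * (suc m * a + m * b)
      ≡⟨ identity d m β a b ⟩
    N * (suc β * (b + a)) + k * (N * b)
      ≡⟨ cong (λ c → N * (suc β * c) + k * (N * b)) (nCk+nC[k+1]≡[n+1]C[k+1] N m) ⟩
    N * (suc β * (suc N C suc m)) + k * (N * b)
      ∎)
    where
    a b : ℕ
    a = N C suc m
    b = N C m
    identity : ∀ d m β a b →
      suc ((2 + d) * suc m + β) * (β * a + suc (suc d + β) * b) + (2 + d) * (suc m * a + m * b)
        ≡ ((2 + d) * suc m + β) * (suc β * (b + a)) + (2 + d) * (((2 + d) * suc m + β) * b)
    identity = solve-∀

  Cser-ballot : ∀ L n β → k * n + β ≡ L → suc L * Cser k 0 β n ≡ suc β * (suc L C n)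
  Cser-ballot zero    zero    zero    eq = cong (1 *_) (Cser≡count 0 0 0 0 (sym eq))
  Cser-ballot zero    zero    (suc β) eq = ⊥-elim (1+n≢0 (trans (sym (+-suc (k * 0) β)) eq))
  Cser-ballot (suc L) n       β       eq = *-cancelˡ-≡ _ _ (suc L) (begin
    suc L * ((2 + L) * Cser k 0 β n)
      ≡⟨ cong (λ c → suc L * ((2 + L) * c)) (Cser-last-step L β n eq) ⟩
    suc L * ((2 + L) * (U-last + D-last))
      ≡⟨ regroup L U-last D-last ⟩
    (2 + L) * (suc L * U-last + suc L * D-last)
      ≡⟨ cong (λ c → (2 + L) * c) (cong₂ _+_ (after-U β eq) (after-D n eq)) ⟩
    (2 + L) * (β * (suc L C n) + shift (λ m → suc (suc d + β) * (suc L C m)) n)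
      ≡⟨ ballot-identity (suc L) n β eq ⟩
    suc L * (suc β * ((2 + L) C n))
      ∎)
    where
    U-last D-last : ℕ
    U-last = down 0 (λ β′ → Cser k 0 β′ n) β
    D-last = shift (Cser k 0 (suc d + β)) n
    regroup : ∀ l u v → suc l * ((2 + l) * (u + v)) ≡ (2 + l) * (suc l * u + suc l * v)
    regroup = solve-∀
    after-U : ∀ β → k * n + β ≡ suc L → suc L * down 0 (λ β′ → Cser k 0 β′ n) β ≡ β * (suc L C n)
    after-U zero     _  = *-zeroʳ (suc L)
    after-U (suc β′) eq = Cser-ballot L n β′ (suc-injective (trans (sym (+-suc (k * n) β′)) eq))
    after-D : ∀ n → k * n + β ≡ suc L →
      suc L * shift (Cser k 0 (suc d + β)) n ≡ shift (λ m → suc (suc d + β) * (suc L C m)) n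
    after-D zero    _  = *-zeroʳ (suc L)
    after-D (suc m) eq = Cser-ballot L m (suc d + β) (suc-injective (trans (shape d m β) eq))
      where
      shape : ∀ d m β → suc ((2 + d) * m + (suc d + β)) ≡ (2 + d) * suc m + β
      shape = solve-∀

  Cser-Cat : ∀ n → Cser k 0 0 n ≡ Cat k n
  Cser-Cat n = begin
    Cser k 0 0 n                                      ≡⟨ sym (m*n/n≡m (Cser k 0 0 n) (suc (k * n))) ⟩
    Cser k 0 0 n * suc (k * n) / suc (k * n)          ≡⟨ cong (_/ suc (k * n)) ballot ⟩
    (suc (k * n) C n) / suc (k * n)                   ∎
    where
    ballot : Cser k 0 0 n * suc (k * n) ≡ suc (k * n) C n
    ballot = trans (*-comm (Cser k 0 0 n) _)
                   (trans (Cser-ballot (k * n) n 0 (+-identityʳ (k * n))) (+-identityʳ _))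

  Cser-Cat-power : ∀ β n → Cser k 0 β n ≡ (Cat k ^ˢ suc β) n
  Cser-Cat-power zero    n = trans (Cser-Cat n) (sym (⊛-identityʳ (Cat k) n))
  Cser-Cat-power (suc β) n = trans (Cser-key 0 β n) (⊛-cong Cser-Cat (Cser-Cat-power β) n)

  Cser-decomposition : ∀ α β n →
    Cser k α β n ≡ sumSer (α ⊓ β) (λ i → Cser k (α ∸ i) 0 ⊛ (Cat k ^ˢ (β ∸ i))) n
  Cser-decomposition zero    zero    n = sym (⊛-identityʳ (Cser k 0 0) n)
  Cser-decomposition (suc α) zero    n = sym (⊛-identityʳ (Cser k (suc α) 0) n)
  Cser-decomposition zero    (suc β) n =
    trans (Cser-key 0 β n) (⊛-cong {f = Cser k 0 0} (λ _ → refl) (Cser-Cat-power β) n)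
  Cser-decomposition (suc α) (suc β) n = begin
    Cser k (suc α) (suc β) n
      ≡⟨ Cser-key (suc α) β n ⟩
    Cser k α β n + (Cser k (suc α) 0 ⊛ Cser k 0 β) n
      ≡⟨ cong₂ _+_ (Cser-decomposition α β n)
                   (⊛-cong {f = Cser k (suc α) 0} (λ _ → refl) (Cser-Cat-power β) n) ⟩
    sumSer (α ⊓ β) (λ i → term (suc i)) n + term 0 n
      ≡⟨ +-comm (sumSer (α ⊓ β) (λ i → term (suc i)) n) (term 0 n) ⟩
    term 0 n + sumSer (α ⊓ β) (λ i → term (suc i)) n
      ≡⟨ sym (sumTo-suc (α ⊓ β) (λ i → term i n)) ⟩
    sumSer (suc α ⊓ suc β) term n
      ∎
    where
    term : ℕ → FPS
    term i = Cser k (suc α ∸ i) 0 ⊛ (Cat k ^ˢ (suc β ∸ i))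

corollary3p6 : (k : ℕ) → 2 ≤ k → (α β : ℕ) → (n : ℕ) →
    Cser k α β n ≡ sumSer (α ⊓ β) (λ i → Cser k (α ∸ i) 0 ⊛ (Cat k ^ˢ (β ∸ i))) n
corollary3p6 (suc (suc d)) (s≤s (s≤s z≤n)) = Paths.Cser-decomposition d
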